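{- Let $G$ be a connected graph with $n$ vertices and feedback edge number $k$ that contains no vertex of degree one. Then $G$ contains at most $\min\{n,2k\}$ vertices of degree at least three and at most $\min\{n,3k\}$ maximal induced paths.
   Context: The feedback edge number of $G$ is the minimum number of edges whose deletion turns $G$ into a forest. A path $P=v_0 v_1\dots v_\ell$ in $G$ (distinct vertices, consecutive ones adjacent) is a maximal induced path if $\ell\ge 2$, the inner vertices $v_1,\dots,v_{\ell-1}$ all have degree exactly two in $G$, and the endpoints satisfy $\deg_G(v_0)\neq 2$ and $\deg_G(v_\ell)\neq 2$. -}

module Defs where

open import Data.Nat using (ℕ; _≤_; _<_; _≤ᵇ_; _+_; _∸_)
open import Data.Bool using (Bool; true; false; T; _∧_)
open import Data.Fin using (Fin) renaming (_<?_ to _<ᶠ?_)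
open import Data.Fin.Base using (toℕ)
open import Data.List using (List; []; _∷_; _++_; length; filterᵇ; allFin; cartesianProduct)
open import Data.List.Relation.Unary.All using (All)
open import Data.List.Relation.Unary.Linked using (Linked)
open import Data.List.Relation.Unary.Unique.Propositional using (Unique)
open import Data.Product using (_×_; _,_; ∃; ∃-syntax)
open import Relation.Binary.PropositionalEquality using (_≡_; _≢_)
open import Relation.Nullary.Decidable using (⌊_⌋)

record Graph (n : ℕ) : Set where
  field
    adj    : Fin n → Fin n → Bool
    sym    : ∀ i j → adj i j ≡ adj j i
    irrefl : ∀ i → adj i i ≡ false
open Graph public

module _ {n : ℕ} where

  Adj : Graph n → Fin n → Fin n → Set
  Adj G i j = T (adj G i j)

  deg : Graph n → Fin n → ℕ
  deg G v = length (filterᵇ (adj G v) (allFin n))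

  edges : Graph n → List (Fin n × Fin n)
  edges G = filterᵇ (λ { (i , j) → ⌊ i <ᶠ? j ⌋ ∧ adj G i j })
                    (cartesianProduct (allFin n) (allFin n))

  numEdges : Graph n → ℕ
  numEdges G = length (edges G)

  _⊆ᴳ_ : Graph n → Graph n → Set
  H ⊆ᴳ G = ∀ i j → Adj H i j → Adj G i j

  IsCycle : Graph n → List (Fin n) → Set
  IsCycle G [] = Data.Empty.⊥ where import Data.Empty
  IsCycle G (v ∷ vs) =
    3 ≤ length (v ∷ vs) × Unique (v ∷ vs) × Linked (Adj G) (v ∷ vs ++ v ∷ [])

  Forest : Graph n → Set
  Forest G = ∀ C → IsCycle G C → Data.Empty.⊥ where import Data.Empty

  IsFeedbackEdgeNumber : Graph n → ℕ → Set
  IsFeedbackEdgeNumber G k =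
    (∃[ H ] (H ⊆ᴳ G × Forest H × numEdges G ∸ numEdges H ≡ k)) ×
    (∀ H → H ⊆ᴳ G → Forest H → k ≤ numEdges G ∸ numEdges H)

  data Reach (G : Graph n) : Fin n → Fin n → Set where
    here  : ∀ {u} → Reach G u u
    there : ∀ {u w v} → Adj G u w → Reach G w v → Reach G u v

  Connected : Graph n → Set
  Connected G = ∀ u v → Reach G u v

  IsMaxInducedPath : Graph n → List (Fin n) → Set
  IsMaxInducedPath G P =
    ∃[ v₀ ] ∃[ w ] ∃[ inner ] ∃[ vₗ ]
      (P ≡ v₀ ∷ (w ∷ inner) ++ vₗ ∷ []
       × Unique P
       × Linked (Adj G) P
       × All (λ x → deg G x ≡ 2) (w ∷ inner)
       × deg G v₀ ≢ 2
       × deg G vₗ ≢ 2)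

  highDegVertices : Graph n → List (Fin n)
  highDegVertices G = filterᵇ (λ v → 3 ≤ᵇ deg G v) (allFin n)

{-# OPTIONS --safe #-}

-- Deleting k edges leaves a forest, and a forest on n vertices has at most n edges (peel off
-- vertices of degree at most one; if none is left, a cycle can be grown), so G has at most n + k
-- edges. If some vertex is isolated, connectivity makes it the only vertex and there is nothing
-- to count. Otherwise every degree is at least two, and counting darts (directed edges) by their
-- tail, the h vertices of degree at least three send at least 3h darts, the n - h others exactly
-- 2(n - h), and all together 2|E| <= 2(n + k); hence h <= 2k. A maximal induced path is determined
-- by its first dart, which leads from an end vertex of degree at least three to a vertex of degree
-- two, because the degree-two inner vertices leave no choice. So p paths distinct up to reversal
-- give 2p distinct such darts: 2p <= 2k + 2h <= 6k counting them by tail, and 2p <= 2(n - h)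
-- counting them reversed.
module Submission where

open import Defs renaming (sym to adj-sym; irrefl to adj-irrefl)
open import Data.Nat using (ℕ; zero; suc; _≤_; _<_; _+_; _*_; _∸_; _⊓_; _≤ᵇ_; z≤n; s≤s)
open import Data.Nat.Properties renaming (_≟_ to _≟ℕ_)
open import Data.Nat.Tactic.RingSolver using (solve-∀)
open import Algebra.Properties.Semiring.Sum +-*-semiring
  using (sum-syntax; ∑-distrib-+; ∑-comm; sum-cong-≗; *-distribˡ-sum; sum-replicate-zero)
open import Data.Bool using (Bool; true; false; T; _∧_; not)
open import Data.Bool.Properties using (T-∧; T-≡)
open import Data.Empty using (⊥-elim)
open import Data.Fin using (Fin; zero; suc) renaming (_<?_ to _<ᶠ?_)
open import Data.Fin.Properties using (_≟_; any?) renaming (<-cmp to <ᶠ-cmp; <-asym to <ᶠ-asym)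
open import Relation.Binary using (tri<; tri≈; tri>)
open import Data.List
  using (List; []; _∷_; _++_; length; filterᵇ; allFin; cartesianProduct; tabulate; map; reverse)
open import Data.List.Properties
  using (length-++; length-map; length-tabulate; map-tabulate; filter-++; ++-assoc;
         unfold-reverse; reverse-++; reverse-involutive; reverse-injective)
open import Data.List.Membership.Propositional using (_∈_)
open import Data.List.Membership.Propositional.Properties
  using (∈-∃++; ∈-++⁺ˡ; ∈-++⁺ʳ; ∈-++⁻; ∈-allFin; ∈-filter⁺; ∈-cartesianProduct⁺)
open import Data.List.Relation.Binary.Subset.Propositional using (_⊆_)
open import Data.List.Relation.Unary.All using (All; []; _∷_)
import Data.List.Relation.Unary.All as All
import Data.List.Relation.Unary.All.Properties as All
import Data.List.Relation.Unary.AllPairs.Properties as AllPairs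
open import Data.List.Relation.Unary.AllPairs using (AllPairs; []; _∷_)
open import Data.List.Relation.Unary.Any using (here; there)
open import Data.List.Relation.Unary.Linked using (Linked; []; [-]; _∷_)
import Data.List.Relation.Unary.Linked as Linked
open import Data.List.Relation.Unary.Unique.Propositional using (Unique)
import Data.List.Relation.Unary.Unique.Propositional.Properties as Unique
open import Data.Product using (_×_; _,_; ∃; ∃₂; proj₁; proj₂; swap)
open import Data.Sum using (inj₁; inj₂)
open import Function using (_∘_; id; flip)
open import Function.Bundles using (Equivalence)
open import Relation.Binary.PropositionalEquality
open import Relation.Nullary using (¬_; yes; no; does; contradiction)
open import Relation.Nullary.Decidable using (⌊_⌋; T?; _×-dec_)

⟦_⟧ : Bool → ℕ
⟦ true ⟧ = 1
⟦ false ⟧ = 0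

⟦⟧≤1 : ∀ b → ⟦ b ⟧ ≤ 1
⟦⟧≤1 true = ≤-refl
⟦⟧≤1 false = z≤n

∑-mono-≤ : ∀ {n} {f g : Fin n → ℕ} → (∀ i → f i ≤ g i) → ∑[ i < n ] f i ≤ ∑[ i < n ] g i
∑-mono-≤ {zero} f≤g = z≤n
∑-mono-≤ {suc n} f≤g = +-mono-≤ (f≤g zero) (∑-mono-≤ (f≤g ∘ suc))

∑-one : ∀ n → ∑[ i < n ] 1 ≡ n
∑-one zero = refl
∑-one (suc n) = cong suc (∑-one n)

∑-δ : ∀ {n} (x : Fin n) (f : Fin n → ℕ) → ∑[ i < n ] (⟦ does (i ≟ x) ⟧ * f i) ≡ f x
∑-δ {suc n} zero f = trans (cong₂ _+_ (+-identityʳ (f zero)) (sum-replicate-zero n)) (+-identityʳ (f zero))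
∑-δ {suc n} (suc x) f = ∑-δ x (f ∘ suc)

∑-positive⇒∃ : ∀ {n} (p : Fin n → Bool) → 0 < ∑[ i < n ] ⟦ p i ⟧ → ∃ λ i → T (p i)
∑-positive⇒∃ {suc n} p pos with p zero in eq
... | true = zero , subst T (sym eq) _
... | false = let (i , pi) = ∑-positive⇒∃ (p ∘ suc) pos in suc i , pi

length-filterᵇ-tabulate : ∀ {A : Set} {n} (p : A → Bool) (f : Fin n → A) →
  length (filterᵇ p (tabulate f)) ≡ ∑[ i < n ] ⟦ p (f i) ⟧
length-filterᵇ-tabulate {n = zero} p f = refl
length-filterᵇ-tabulate {n = suc n} p f with p (f zero)
... | true = cong suc (length-filterᵇ-tabulate p (f ∘ suc))
... | false = length-filterᵇ-tabulate p (f ∘ suc)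

length-filterᵇ-cartesianProduct : ∀ {A : Set} {m n} (q : A × Fin n → Bool) (f : Fin m → A) →
  length (filterᵇ q (cartesianProduct (tabulate f) (allFin n))) ≡ ∑[ i < m ] ∑[ j < n ] ⟦ q (f i , j) ⟧
length-filterᵇ-cartesianProduct {m = zero} q f = refl
length-filterᵇ-cartesianProduct {m = suc m} {n} q f = begin
  length (filterᵇ q (row ++ rows))                 ≡⟨ cong length (filter-++ _ row rows) ⟩
  length (filterᵇ q row ++ filterᵇ q rows)         ≡⟨ length-++ (filterᵇ q row) ⟩
  length (filterᵇ q row) + length (filterᵇ q rows) ≡⟨ cong₂ _+_ first-row other-rows ⟩
  ∑[ i < suc m ] ∑[ j < n ] ⟦ q (f i , j) ⟧        ∎
  where
  open ≡-Reasoning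
  row = map (f zero ,_) (allFin n)
  rows = cartesianProduct (tabulate (f ∘ suc)) (allFin n)
  first-row : length (filterᵇ q row) ≡ ∑[ j < n ] ⟦ q (f zero , j) ⟧
  first-row = trans (cong (length ∘ filterᵇ q) (map-tabulate id (f zero ,_)))
                    (length-filterᵇ-tabulate q (f zero ,_))
  other-rows = length-filterᵇ-cartesianProduct q (f ∘ suc)

Unique-length-≤ : ∀ {A : Set} {xs ys : List A} → Unique xs → xs ⊆ ys → length xs ≤ length ys
Unique-length-≤ {xs = []} _ _ = z≤n
Unique-length-≤ {xs = x ∷ xs} (x∉xs ∷ unique) xs⊆ys with ∈-∃++ (xs⊆ys (here refl))
... | ys₁ , ys₂ , refl = begin
  suc (length xs)                  ≤⟨ s≤s (Unique-length-≤ unique xs⊆ys₁++ys₂) ⟩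
  suc (length (ys₁ ++ ys₂))        ≡⟨ cong suc (length-++ ys₁) ⟩
  suc (length ys₁ + length ys₂)    ≡⟨ +-suc (length ys₁) (length ys₂) ⟨
  length ys₁ + length (x ∷ ys₂)    ≡⟨ length-++ ys₁ ⟨
  length (ys₁ ++ x ∷ ys₂)          ∎
  where
  open ≤-Reasoning
  xs⊆ys₁++ys₂ : xs ⊆ ys₁ ++ ys₂
  xs⊆ys₁++ys₂ z∈xs with ∈-++⁻ ys₁ (xs⊆ys (there z∈xs))
  ... | inj₁ z∈ys₁ = ∈-++⁺ˡ z∈ys₁
  ... | inj₂ (here refl) = ⊥-elim (All.lookup x∉xs z∈xs refl)
  ... | inj₂ (there z∈ys₂) = ∈-++⁺ʳ ys₁ z∈ys₂

Unique⇒length≤ : ∀ {n} {xs : List (Fin n)} → Unique xs → length xs ≤ n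
Unique⇒length≤ {n} unique =
  ≤-trans (Unique-length-≤ unique (λ {x} _ → ∈-allFin x)) (≤-reflexive (length-tabulate id))

module _ {A : Set} where

  All-reverse : ∀ {P : A → Set} {xs} → All P xs → All P (reverse xs)
  All-reverse [] = []
  All-reverse {xs = x ∷ xs} (px ∷ pxs) =
    subst (All _) (sym (unfold-reverse x xs)) (All.++⁺ (All-reverse pxs) (px ∷ []))

  Unique-reverse : ∀ {xs : List A} → Unique xs → Unique (reverse xs)
  Unique-reverse [] = []
  Unique-reverse {x ∷ xs} (x∉xs ∷ unique) = subst Unique (sym (unfold-reverse x xs))
    (AllPairs.++⁺ (Unique-reverse unique) ([] ∷ [])
                  (All.map (λ y≢x → ≢-sym y≢x ∷ []) (All-reverse x∉xs)))

  DistinctUpToReversal : List A → List A → Set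
  DistinctUpToReversal xs ys = xs ≢ ys × xs ≢ reverse ys

  reverse-∷ : ∀ (x : A) xs → ∃₂ λ y ys → reverse (x ∷ xs) ≡ y ∷ ys
  reverse-∷ x xs with reverse xs in eq
  ... | [] = x , [] , trans (unfold-reverse x xs) (cong (_++ x ∷ []) eq)
  ... | y ∷ ys = y , ys ++ x ∷ [] , trans (unfold-reverse x xs) (cong (_++ x ∷ []) eq)

  Unique-++⁻ˡ : ∀ xs {ys : List A} → Unique (xs ++ ys) → Unique xs
  Unique-++⁻ˡ [] _ = []
  Unique-++⁻ˡ (x ∷ xs) (x∉ ∷ unique) = All.++⁻ˡ xs x∉ ∷ Unique-++⁻ˡ xs unique

  Linked-++⁻ˡ : ∀ {R : A → A → Set} xs {ys} → Linked R (xs ++ ys) → Linked R xs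
  Linked-++⁻ˡ [] _ = []
  Linked-++⁻ˡ (x ∷ []) _ = [-]
  Linked-++⁻ˡ (x ∷ y ∷ xs) (r ∷ linked) = r ∷ Linked-++⁻ˡ (y ∷ xs) linked

  Linked-snoc : ∀ {R : A → A → Set} xs {y z} →
                Linked R (xs ++ y ∷ []) → R y z → Linked R (xs ++ y ∷ z ∷ [])
  Linked-snoc [] _ r = r ∷ [-]
  Linked-snoc (x ∷ []) (r′ ∷ _) r = r′ ∷ r ∷ [-]
  Linked-snoc (x ∷ x′ ∷ xs) (r′ ∷ linked) r = r′ ∷ Linked-snoc (x′ ∷ xs) linked r

  Linked-reverse : ∀ {R : A → A → Set} {xs} → Linked R xs → Linked (flip R) (reverse xs)
  Linked-reverse {xs = []} [] = []
  Linked-reverse {R} {x ∷ xs} linked = subst (Linked (flip R)) (sym (unfold-reverse x xs)) (go x xs linked)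
    where
    go : ∀ x xs → Linked R (x ∷ xs) → Linked (flip R) (reverse xs ++ x ∷ [])
    go x [] _ = [-]
    go x (y ∷ ys) (r ∷ linked) =
      subst (Linked (flip R)) reassociate (Linked-snoc (reverse ys) (go y ys linked) r)
      where
      reassociate : reverse ys ++ y ∷ x ∷ [] ≡ reverse (y ∷ ys) ++ x ∷ []
      reassociate = trans (sym (++-assoc (reverse ys) (y ∷ []) (x ∷ [])))
                          (cong (_++ x ∷ []) (sym (unfold-reverse y ys)))

module _ {n : ℕ} (G : Graph n) where

  Adj-sym : ∀ {x y} → Adj G x y → Adj G y x
  Adj-sym {x} {y} = subst T (adj-sym G x y)

  Adj-irrefl : ∀ {x} → ¬ Adj G x x
  Adj-irrefl {x} = subst T (adj-irrefl G x)

  ∈-neighbours : ∀ {v x} → Adj G v x → x ∈ filterᵇ (adj G v) (allFin n)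
  ∈-neighbours {v} {x} = ∈-filter⁺ (T? ∘ adj G v) (∈-allFin x)

  deg≡∑ : ∀ v → deg G v ≡ ∑[ u < n ] ⟦ adj G v u ⟧
  deg≡∑ v = length-filterᵇ-tabulate (adj G v) id

  handshake : 2 * numEdges G ≡ ∑[ u < n ] deg G u
  handshake = begin
    2 * numEdges G
      ≡⟨ cong (2 *_) (length-filterᵇ-cartesianProduct (λ (i , j) → lower i j) id) ⟩
    E + (E + 0)
      ≡⟨ cong (E +_) (trans (+-identityʳ E) (∑-comm (λ i j → ⟦ lower i j ⟧))) ⟩
    E + ∑[ i < n ] ∑[ j < n ] ⟦ lower j i ⟧
      ≡⟨ ∑-distrib-+ (λ i → ∑[ j < n ] ⟦ lower i j ⟧) (λ i → ∑[ j < n ] ⟦ lower j i ⟧) ⟨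
    ∑[ i < n ] (∑[ j < n ] ⟦ lower i j ⟧ + ∑[ j < n ] ⟦ lower j i ⟧)
      ≡⟨ sum-cong-≗ (λ i → sym (∑-distrib-+ (λ j → ⟦ lower i j ⟧) (λ j → ⟦ lower j i ⟧))) ⟩
    ∑[ i < n ] ∑[ j < n ] (⟦ lower i j ⟧ + ⟦ lower j i ⟧)
      ≡⟨ sum-cong-≗ (λ i → sum-cong-≗ (each-edge-twice i)) ⟩
    ∑[ i < n ] ∑[ j < n ] ⟦ adj G i j ⟧
      ≡⟨ sum-cong-≗ deg≡∑ ⟨
    ∑[ u < n ] deg G u
      ∎
    where
    open ≡-Reasoning
    lower : Fin n → Fin n → Bool
    lower i j = ⌊ i <ᶠ? j ⌋ ∧ adj G i j
    E = ∑[ i < n ] ∑[ j < n ] ⟦ lower i j ⟧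
    each-edge-twice : ∀ i j → ⟦ lower i j ⟧ + ⟦ lower j i ⟧ ≡ ⟦ adj G i j ⟧
    each-edge-twice i j with i <ᶠ? j | j <ᶠ? i
    ... | yes i<j | yes j<i = ⊥-elim (<ᶠ-asym i<j j<i)
    ... | yes _ | no _ = +-identityʳ _
    ... | no _ | yes _ = cong ⟦_⟧ (adj-sym G j i)
    ... | no i≮j | no j≮i with <ᶠ-cmp i j
    ...   | tri< i<j _ _ = ⊥-elim (i≮j i<j)
    ...   | tri> _ _ j<i = ⊥-elim (j≮i j<i)
    ...   | tri≈ _ refl _ = cong ⟦_⟧ (sym (adj-irrefl G i))

VertexSet : ℕ → Set
VertexSet n = Fin n → Bool

∣_∣ : ∀ {n} → VertexSet n → ℕ
∣_∣ {n} S = ∑[ u < n ] ⟦ S u ⟧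

_─_ : ∀ {n} → VertexSet n → Fin n → VertexSet n
(S ─ x) u = not (does (u ≟ x)) ∧ S u

∣─∣ : ∀ {n} (S : VertexSet n) {x} → T (S x) → ∣ S ∣ ≡ suc ∣ S ─ x ∣
∣─∣ {n} S {x} x∈S = begin
  ∑[ u < n ] ⟦ S u ⟧                       ≡⟨ sum-cong-≗ split ⟩
  ∑[ u < n ] (⟦ (S ─ x) u ⟧ + δ u)          ≡⟨ ∑-distrib-+ (λ u → ⟦ (S ─ x) u ⟧) δ ⟩
  ∣ S ─ x ∣ + ∑[ u < n ] δ u                ≡⟨ cong (∣ S ─ x ∣ +_) (∑-δ x (λ _ → 1)) ⟩
  ∣ S ─ x ∣ + 1                            ≡⟨ +-comm ∣ S ─ x ∣ 1 ⟩
  suc ∣ S ─ x ∣                            ∎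
  where
  open ≡-Reasoning
  δ : Fin n → ℕ
  δ u = ⟦ does (u ≟ x) ⟧ * 1
  split : ∀ u → ⟦ S u ⟧ ≡ ⟦ (S ─ x) u ⟧ + δ u
  split u with u ≟ x
  ... | yes refl rewrite Equivalence.to T-≡ x∈S = refl
  ... | no _ = sym (+-identityʳ ⟦ S u ⟧)

∈─ : ∀ {n} (S : VertexSet n) {x u} → T ((S ─ x) u) → T (S u) × u ≢ x
∈─ S {x} {u} u∈S─x with u ≟ x
... | no u≢x = u∈S─x , u≢x

module _ {n : ℕ} (H : Graph n) where

  degIn : VertexSet n → Fin n → ℕ
  degIn S x = ∑[ v < n ] ⟦ S v ∧ adj H x v ⟧

  degSumIn : VertexSet n → ℕ
  degSumIn S = ∑[ u < n ] ∑[ v < n ] ⟦ S u ∧ (S v ∧ adj H u v) ⟧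

  degIn-─ : ∀ S x v → degIn S v ≤ suc (degIn (S ─ x) v)
  degIn-─ S x v = begin
    degIn S v                                           ≤⟨ ∑-mono-≤ pointwise ⟩
    ∑[ u < n ] (⟦ (S ─ x) u ∧ adj H v u ⟧ + δ u)        ≡⟨ ∑-distrib-+ (λ u → ⟦ (S ─ x) u ∧ adj H v u ⟧) δ ⟩
    degIn (S ─ x) v + ∑[ u < n ] δ u                    ≡⟨ cong (degIn (S ─ x) v +_) (∑-δ x (λ _ → 1)) ⟩
    degIn (S ─ x) v + 1                                 ≡⟨ +-comm (degIn (S ─ x) v) 1 ⟩
    suc (degIn (S ─ x) v)                               ∎
    where
    open ≤-Reasoning
    δ : Fin n → ℕ
    δ u = ⟦ does (u ≟ x) ⟧ * 1
    pointwise : ∀ u → ⟦ S u ∧ adj H v u ⟧ ≤ ⟦ (S ─ x) u ∧ adj H v u ⟧ + δ u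
    pointwise u with u ≟ x
    ... | yes _ = ⟦⟧≤1 (S u ∧ adj H v u)
    ... | no _ = m≤m+n ⟦ S u ∧ adj H v u ⟧ 0

  neighbourIn : ∀ S {v} → 0 < degIn S v → ∃ λ u → T (S u) × Adj H v u
  neighbourIn S {v} positive with u , u∈S∧v~u ← ∑-positive⇒∃ (λ u → S u ∧ adj H v u) positive =
    u , Equivalence.to T-∧ u∈S∧v~u

  neighbourIn-avoiding : ∀ S {v} → 2 ≤ degIn S v → ∀ r → ∃ λ u → T (S u) × Adj H v u × u ≢ r
  neighbourIn-avoiding S {v} 2≤deg r
    with u , u∈S─r , v~u ← neighbourIn (S ─ r) (≤-pred (≤-trans 2≤deg (degIn-─ S r v)))
    with u∈S , u≢r ← ∈─ S u∈S─r = u , u∈S , v~u , u≢r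

  degSumIn-─ : ∀ S x → degSumIn S ≤ degSumIn (S ─ x) + 2 * degIn S x
  degSumIn-─ S x = begin
    degSumIn S
      ≤⟨ ∑-mono-≤ (λ u → ∑-mono-≤ (λ v →
           removal-bound (S u) (S v) (does (u ≟ x)) (does (v ≟ x)) (adj H u v))) ⟩
    ∑[ u < n ] ∑[ v < n ] (kept u v + (fromX u v + toX u v))
      ≡⟨ sum-cong-≗ (λ u → distrib₃ (kept u) (fromX u) (toX u)) ⟩
    ∑[ u < n ] (∑[ v < n ] kept u v + (∑[ v < n ] fromX u v + ∑[ v < n ] toX u v))
      ≡⟨ distrib₃ (λ u → ∑[ v < n ] kept u v) _ _ ⟩
    degSumIn (S ─ x) + (∑[ u < n ] ∑[ v < n ] fromX u v + ∑[ u < n ] ∑[ v < n ] toX u v)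
      ≡⟨ cong (degSumIn (S ─ x) +_) (cong₂ _+_ ∑fromX ∑toX) ⟩
    degSumIn (S ─ x) + (degIn S x + degIn S x)
      ≡⟨ cong (λ d → degSumIn (S ─ x) + (degIn S x + d)) (+-identityʳ _) ⟨
    degSumIn (S ─ x) + 2 * degIn S x
      ∎
    where
    open ≤-Reasoning
    removal-bound : ∀ su sv eu ev a →
      ⟦ su ∧ (sv ∧ a) ⟧ ≤
      ⟦ (not eu ∧ su) ∧ ((not ev ∧ sv) ∧ a) ⟧ + (⟦ eu ⟧ * ⟦ sv ∧ a ⟧ + ⟦ ev ⟧ * ⟦ su ∧ a ⟧)
    removal-bound false _ _ _ _ = z≤n
    removal-bound true false _ _ _ = z≤n
    removal-bound true true _ _ false = z≤n
    removal-bound true true true _ true = s≤s z≤n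
    removal-bound true true false true true = s≤s z≤n
    removal-bound true true false false true = s≤s z≤n
    kept fromX toX : Fin n → Fin n → ℕ
    kept u v = ⟦ (S ─ x) u ∧ ((S ─ x) v ∧ adj H u v) ⟧
    fromX u v = ⟦ does (u ≟ x) ⟧ * ⟦ S v ∧ adj H u v ⟧
    toX u v = ⟦ does (v ≟ x) ⟧ * ⟦ S u ∧ adj H u v ⟧
    distrib₃ : ∀ (f g h : Fin n → ℕ) →
               ∑[ i < n ] (f i + (g i + h i)) ≡ ∑[ i < n ] f i + (∑[ i < n ] g i + ∑[ i < n ] h i)
    distrib₃ f g h = trans (∑-distrib-+ f _) (cong (∑[ i < n ] f i +_) (∑-distrib-+ g h))
    ∑fromX : ∑[ u < n ] ∑[ v < n ] fromX u v ≡ degIn S x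
    ∑fromX = trans (sum-cong-≗ (λ u → sym (*-distribˡ-sum ⟦ does (u ≟ x) ⟧ (λ v → ⟦ S v ∧ adj H u v ⟧))))
                   (∑-δ x (λ u → degIn S u))
    ∑toX : ∑[ u < n ] ∑[ v < n ] toX u v ≡ degIn S x
    ∑toX = sum-cong-≗ (λ u → trans (∑-δ x (λ v → ⟦ S u ∧ adj H u v ⟧))
                                   (cong (λ b → ⟦ S u ∧ b ⟧) (adj-sym H u x)))

  degSumIn-∅ : ∀ S → (∀ u → ¬ T (S u)) → degSumIn S ≡ 0
  degSumIn-∅ S empty = trans (sum-cong-≗ row) (sum-replicate-zero n)
    where
    row : ∀ u → ∑[ v < n ] ⟦ S u ∧ (S v ∧ adj H u v) ⟧ ≡ 0
    row u with S u | empty u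
    ... | true | u∉S = ⊥-elim (u∉S _)
    ... | false | _ = sum-replicate-zero n

  close-cycle : ∀ {v r w} ys zs →
                Unique (v ∷ r ∷ ys ++ w ∷ zs) → Linked (Adj H) (v ∷ r ∷ ys ++ w ∷ zs) → Adj H w v →
                IsCycle H (v ∷ r ∷ ys ++ w ∷ [])
  close-cycle {v} {r} {w} ys zs unique linked w~v =
    length≥3 , Unique-++⁻ˡ cycle (subst Unique split unique) , closed
    where
    cycle = v ∷ r ∷ ys ++ w ∷ []
    split : v ∷ r ∷ ys ++ w ∷ zs ≡ cycle ++ zs
    split = cong (λ t → v ∷ r ∷ t) (sym (++-assoc ys (w ∷ []) zs))
    length≥3 : 3 ≤ length cycle
    length≥3 = s≤s (s≤s (≤-trans (m≤n+m 1 (length ys)) (≤-reflexive (sym (length-++ ys)))))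
    closed : Linked (Adj H) (v ∷ (r ∷ ys ++ w ∷ []) ++ v ∷ [])
    closed = subst (Linked (Adj H)) (cong (λ t → v ∷ r ∷ t) (sym (++-assoc ys (w ∷ []) (v ∷ []))))
               (Linked-snoc (v ∷ r ∷ ys) (Linked-++⁻ˡ cycle (subst (Linked (Adj H)) split linked)) w~v)

  cycle-of-minDegIn≥2 : ∀ S → (∀ x → T (S x) → 2 ≤ degIn S x) →
                        ∀ {x₀} → T (S x₀) → ∃ (IsCycle H)
  cycle-of-minDegIn≥2 S minDeg {x₀} x₀∈S = grow n x₀ [] ≤-refl ([] ∷ []) [-] x₀∈S
    where
    open import Data.List.Membership.DecPropositional (_≟_ {n}) using (_∈?_)
    previous : Fin n → List (Fin n) → Fin n
    previous v [] = v
    previous _ (r ∷ _) = r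
    -- the path v ∷ rest is grown at its front; fuel outlasts every path without repeated vertices
    grow : ∀ fuel v rest → n < length (v ∷ rest) + fuel →
           Unique (v ∷ rest) → Linked (Adj H) (v ∷ rest) → T (S v) → ∃ (IsCycle H)
    grow zero v rest tooLong unique _ _ =
      ⊥-elim (<⇒≱ (≤-trans tooLong (≤-reflexive (+-identityʳ _))) (Unique⇒length≤ unique))
    grow (suc fuel) v rest tooLong unique linked v∈S
      with neighbourIn-avoiding S (minDeg v v∈S) (previous v rest)
    ... | w , w∈S , v~w , _ with w ∈? v ∷ rest
    ...   | no w∉path = grow fuel w (v ∷ rest) (≤-trans tooLong (≤-reflexive (+-suc _ fuel)))
                          (All.¬Any⇒All¬ _ w∉path ∷ unique) (Adj-sym H v~w ∷ linked) w∈S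
    ...   | yes (here refl) = ⊥-elim (Adj-irrefl H v~w)
    grow (suc fuel) v (r ∷ rest) _ unique linked _ | w , _ , _ , w≢r | yes (there (here refl)) =
      ⊥-elim (w≢r refl)
    grow (suc fuel) v (r ∷ rest) _ unique linked _ | w , _ , v~w , _ | yes (there (there w∈rest))
      with ys , zs , refl ← ∈-∃++ w∈rest = _ , close-cycle ys zs unique linked (Adj-sym H v~w)

  Forest⇒degSumIn≤2∣∣ : Forest H → ∀ S → degSumIn S ≤ 2 * ∣ S ∣
  Forest⇒degSumIn≤2∣∣ forest S = go ∣ S ∣ S refl
    where
    go : ∀ c S → ∣ S ∣ ≡ c → degSumIn S ≤ 2 * c
    go c S ∣S∣≡c with any? (λ x → T? (S x) ×-dec (degIn S x ≤? 1))
    go zero S ∣S∣≡0 | yes (x , x∈S , _) = contradiction (trans (sym ∣S∣≡0) (∣─∣ S x∈S)) λ ()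
    go (suc c) S ∣S∣≡1+c | yes (x , x∈S , degIn≤1) = begin
      degSumIn S                        ≤⟨ degSumIn-─ S x ⟩
      degSumIn (S ─ x) + 2 * degIn S x  ≤⟨ +-mono-≤ (go c (S ─ x) ∣S─x∣≡c) (*-monoʳ-≤ 2 degIn≤1) ⟩
      2 * c + 2 * 1                     ≡⟨ *-distribˡ-+ 2 c 1 ⟨
      2 * (c + 1)                       ≡⟨ cong (2 *_) (+-comm c 1) ⟩
      2 * suc c                         ∎
      where
      open ≤-Reasoning
      ∣S─x∣≡c = suc-injective (trans (sym (∣─∣ S x∈S)) ∣S∣≡1+c)
    ... | no noLowVertex with any? (T? ∘ S)
    ...   | yes (x₀ , x₀∈S) = ⊥-elim (forest _ (proj₂ (cycle-of-minDegIn≥2 S minDeg x₀∈S)))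
      where
      minDeg : ∀ x → T (S x) → 2 ≤ degIn S x
      minDeg x x∈S = ≰⇒> (λ degIn≤1 → noLowVertex (x , x∈S , degIn≤1))
    ...   | no empty = ≤-trans (≤-reflexive (degSumIn-∅ S (λ u u∈S → empty (u , u∈S)))) z≤n

  Forest⇒numEdges≤n : Forest H → numEdges H ≤ n
  Forest⇒numEdges≤n forest = *-cancelˡ-≤ 2 (begin
    2 * numEdges H              ≡⟨ handshake H ⟩
    ∑[ u < n ] deg H u          ≡⟨ sum-cong-≗ (deg≡∑ H) ⟩
    degSumIn everything         ≤⟨ Forest⇒degSumIn≤2∣∣ forest everything ⟩
    2 * ∣ everything ∣          ≡⟨ cong (2 *_) (∑-one n) ⟩
    2 * n                       ∎)
    where
    open ≤-Reasoning
    everything : VertexSet n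
    everything _ = true

module _ {n : ℕ} (G : Graph n) where

  deg≡2⇒neighbour-unique : ∀ {b x c d} → deg G b ≡ 2 → Adj G b x → Adj G b c → Adj G b d →
                            x ≢ c → x ≢ d → c ≡ d
  deg≡2⇒neighbour-unique {b} {x} {c} {d} deg≡2 b~x b~c b~d x≢c x≢d with c ≟ d
  ... | yes c≡d = c≡d
  ... | no c≢d =
    contradiction (subst (3 ≤_) deg≡2 (Unique-length-≤ distinct neighbours)) λ { (s≤s (s≤s ())) }
    where
    distinct : Unique (x ∷ c ∷ d ∷ [])
    distinct = (x≢c ∷ x≢d ∷ []) ∷ (c≢d ∷ []) ∷ [] ∷ []
    neighbours : x ∷ c ∷ d ∷ [] ⊆ filterᵇ (adj G b) (allFin n)
    neighbours (here refl) = ∈-neighbours G b~x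
    neighbours (there (here refl)) = ∈-neighbours G b~c
    neighbours (there (there (here refl))) = ∈-neighbours G b~d

  -- a maximal induced path with the degree of its first vertex forgotten, so that
  -- Deg2Run-unique can be proved by walking along the path
  Deg2Run : Fin n → Fin n → List (Fin n) → Fin n → Set
  Deg2Run x b inner e =
    Unique P × Linked (Adj G) P × All (λ v → deg G v ≡ 2) (b ∷ inner) × deg G e ≢ 2
    where P = x ∷ b ∷ inner ++ e ∷ []

  Deg2Run-unique : ∀ {x b} i₁ i₂ {e₁ e₂} →
                   Deg2Run x b i₁ e₁ → Deg2Run x b i₂ e₂ → i₁ ≡ i₂ × e₁ ≡ e₂
  Deg2Run-unique [] [] ((_ ∷ x≢e₁ ∷ []) ∷ _ , x~b ∷ b~e₁ ∷ _ , deg-b ∷ _ , _)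
                       ((_ ∷ x≢e₂ ∷ []) ∷ _ , _ ∷ b~e₂ ∷ _ , _ , _) =
    refl , deg≡2⇒neighbour-unique deg-b (Adj-sym G x~b) b~e₁ b~e₂ x≢e₁ x≢e₂
  Deg2Run-unique [] (c ∷ _) ((_ ∷ x≢e₁ ∷ []) ∷ _ , x~b ∷ b~e₁ ∷ _ , deg-b ∷ _ , deg-e₁)
                            ((_ ∷ x≢c ∷ _) ∷ _ , _ ∷ b~c ∷ _ , _ ∷ deg-c ∷ _ , _) =
    ⊥-elim (deg-e₁ (trans (cong (deg G) c≡e₁) deg-c))
    where c≡e₁ = deg≡2⇒neighbour-unique deg-b (Adj-sym G x~b) b~e₁ b~c x≢e₁ x≢c
  Deg2Run-unique (c ∷ _) [] ((_ ∷ x≢c ∷ _) ∷ _ , x~b ∷ b~c ∷ _ , deg-b ∷ deg-c ∷ _ , _)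
                            ((_ ∷ x≢e₂ ∷ []) ∷ _ , _ ∷ b~e₂ ∷ _ , _ , deg-e₂) =
    ⊥-elim (deg-e₂ (trans (cong (deg G) c≡e₂) deg-c))
    where c≡e₂ = deg≡2⇒neighbour-unique deg-b (Adj-sym G x~b) b~e₂ b~c x≢e₂ x≢c
  Deg2Run-unique (c₁ ∷ i₁) (c₂ ∷ i₂)
    ((_ ∷ x≢c₁ ∷ _) ∷ unique₁ , x~b ∷ linked₁@(b~c₁ ∷ _) , deg-b ∷ deg₁ , deg-e₁)
    ((_ ∷ x≢c₂ ∷ _) ∷ unique₂ , _ ∷ linked₂@(b~c₂ ∷ _) , _ ∷ deg₂ , deg-e₂)
    with refl ← deg≡2⇒neighbour-unique deg-b (Adj-sym G x~b) b~c₁ b~c₂ x≢c₁ x≢c₂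
    with refl , refl ← Deg2Run-unique i₁ i₂ (unique₁ , linked₁ , deg₁ , deg-e₁)
                                            (unique₂ , linked₂ , deg₂ , deg-e₂) =
    refl , refl

  IsMaxInducedPath-reverse : ∀ {P} → IsMaxInducedPath G P → IsMaxInducedPath G (reverse P)
  IsMaxInducedPath-reverse (v₀ , w , inner , vₗ , refl , unique , linked , deg-inner , deg-v₀ , deg-vₗ)
    with w′ , inner′ , reverse-inner ← reverse-∷ w inner =
    vₗ , w′ , inner′ , v₀ , reverse-P , Unique-reverse unique , Linked.map (Adj-sym G) (Linked-reverse linked) ,
    subst (All (λ v → deg G v ≡ 2)) reverse-inner (All-reverse deg-inner) , deg-vₗ , deg-v₀
    where
    reverse-P : reverse (v₀ ∷ (w ∷ inner) ++ vₗ ∷ []) ≡ vₗ ∷ (w′ ∷ inner′) ++ v₀ ∷ []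
    reverse-P = trans (unfold-reverse v₀ ((w ∷ inner) ++ vₗ ∷ []))
                  (cong (_++ v₀ ∷ []) (trans (reverse-++ (w ∷ inner) (vₗ ∷ []))
                                             (cong (vₗ ∷_) reverse-inner)))

  firstDart : ∀ {P} → IsMaxInducedPath G P → Fin n × Fin n
  firstDart (v₀ , w , _) = v₀ , w

  lastDart : ∀ {P} → IsMaxInducedPath G P → Fin n × Fin n
  lastDart = firstDart ∘ IsMaxInducedPath-reverse

  firstDart-injective : ∀ {P Q} (p : IsMaxInducedPath G P) (q : IsMaxInducedPath G Q) →
                        firstDart p ≡ firstDart q → P ≡ Q
  firstDart-injective (v₀ , w , i₁ , e₁ , refl , run₁) (_ , _ , i₂ , e₂ , refl , run₂) refl
    with unique₁ , linked₁ , deg₁ , _ , deg-e₁ ← run₁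
    with unique₂ , linked₂ , deg₂ , _ , deg-e₂ ← run₂
    with refl , refl ← Deg2Run-unique i₁ i₂ (unique₁ , linked₁ , deg₁ , deg-e₁)
                                            (unique₂ , linked₂ , deg₂ , deg-e₂) = refl

  firstDart≢lastDart : ∀ {P} (p : IsMaxInducedPath G P) → firstDart p ≢ lastDart p
  firstDart≢lastDart (_ , w , inner , _ , refl , (v₀∉ ∷ _) , _) v₀,w≡vₗ,w′ =
    All.lookup v₀∉ (∈-++⁺ʳ (w ∷ inner) (here refl)) (cong proj₁ v₀,w≡vₗ,w′)

  DistinctUpToReversal⇒endDarts-differ : ∀ {P Q} (p : IsMaxInducedPath G P) (q : IsMaxInducedPath G Q) →
    DistinctUpToReversal P Q →
    firstDart p ≢ firstDart q × firstDart p ≢ lastDart q × lastDart p ≢ firstDart q × lastDart p ≢ lastDart q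
  DistinctUpToReversal⇒endDarts-differ {P} p q (P≢Q , P≢Qʳ) =
    (λ eq → P≢Q (firstDart-injective p q eq)) ,
    (λ eq → P≢Qʳ (firstDart-injective p qʳ eq)) ,
    (λ eq → P≢Qʳ (trans (sym (reverse-involutive P)) (cong reverse (firstDart-injective pʳ q eq)))) ,
    (λ eq → P≢Q (reverse-injective (firstDart-injective pʳ qʳ eq)))
    where
    pʳ = IsMaxInducedPath-reverse p
    qʳ = IsMaxInducedPath-reverse q

  endDarts : ∀ {Ps} → All (IsMaxInducedPath G) Ps → List (Fin n × Fin n)
  endDarts [] = []
  endDarts (p ∷ ps) = firstDart p ∷ lastDart p ∷ endDarts ps

  length-endDarts : ∀ {Ps} (ps : All (IsMaxInducedPath G) Ps) → length (endDarts ps) ≡ 2 * length Ps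
  length-endDarts [] = refl
  length-endDarts {_ ∷ Ps} (_ ∷ ps) = trans (cong (2 +_) (length-endDarts ps)) (sym (*-suc 2 (length Ps)))

  All-endDarts : ∀ {Q : Fin n × Fin n → Set} → (∀ {P} (p : IsMaxInducedPath G P) → Q (firstDart p)) →
                 ∀ {Ps} (ps : All (IsMaxInducedPath G) Ps) → All Q (endDarts ps)
  All-endDarts Q-firstDart [] = []
  All-endDarts Q-firstDart (p ∷ ps) =
    Q-firstDart p ∷ Q-firstDart (IsMaxInducedPath-reverse p) ∷ All-endDarts Q-firstDart ps

  firstDart,lastDart∉endDarts : ∀ {P Qs} (p : IsMaxInducedPath G P) (qs : All (IsMaxInducedPath G) Qs) →
    All (DistinctUpToReversal P) Qs → All (firstDart p ≢_) (endDarts qs) × All (lastDart p ≢_) (endDarts qs)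
  firstDart,lastDart∉endDarts p [] [] = [] , []
  firstDart,lastDart∉endDarts p (q ∷ qs) (distinct ∷ distincts)
    with ff , fl , lf , ll ← DistinctUpToReversal⇒endDarts-differ p q distinct
    with firstDart∉ , lastDart∉ ← firstDart,lastDart∉endDarts p qs distincts =
    (ff ∷ fl ∷ firstDart∉) , (lf ∷ ll ∷ lastDart∉)

  endDarts-unique : ∀ {Ps} (ps : All (IsMaxInducedPath G) Ps) →
                    AllPairs DistinctUpToReversal Ps → Unique (endDarts ps)
  endDarts-unique [] [] = []
  endDarts-unique (p ∷ ps) (distinct ∷ distincts)
    with firstDart∉ , lastDart∉ ← firstDart,lastDart∉endDarts p ps distinct =
    (firstDart≢lastDart p ∷ firstDart∉) ∷ lastDart∉ ∷ endDarts-unique ps distincts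

module _ {n : ℕ} (G : Graph n) where

  high : VertexSet n
  high u = 3 ≤ᵇ deg G u

  low : VertexSet n
  low u = not (high u)

  length-highDegVertices : length (highDegVertices G) ≡ ∣ high ∣
  length-highDegVertices = length-filterᵇ-tabulate high id

  ∣low∣+∣high∣≡n : ∣ low ∣ + ∣ high ∣ ≡ n
  ∣low∣+∣high∣≡n = trans (sym (∑-distrib-+ (λ u → ⟦ low u ⟧) (λ u → ⟦ high u ⟧)))
                          (trans (sum-cong-≗ (λ u → partition (high u))) (∑-one n))
    where
    partition : ∀ b → ⟦ not b ⟧ + ⟦ b ⟧ ≡ 1
    partition true = refl
    partition false = refl

  ∣high∣≤n : ∣ high ∣ ≤ n
  ∣high∣≤n = subst (∣ high ∣ ≤_) ∣low∣+∣high∣≡n (m≤n+m ∣ high ∣ ∣ low ∣)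

  dartsFrom : VertexSet n → List (Fin n × Fin n)
  dartsFrom S = filterᵇ (λ (u , v) → S u ∧ adj G u v) (cartesianProduct (allFin n) (allFin n))

  ∈-dartsFrom : ∀ S {u v} → T (S u) → Adj G u v → (u , v) ∈ dartsFrom S
  ∈-dartsFrom S {u} {v} u∈S u~v =
    ∈-filter⁺ (T? ∘ _) (∈-cartesianProduct⁺ (∈-allFin u) (∈-allFin v))
              (Equivalence.from T-∧ (u∈S , u~v))

  length-dartsFrom : ∀ S → length (dartsFrom S) ≡ ∑[ u < n ] (⟦ S u ⟧ * deg G u)
  length-dartsFrom S =
    trans (length-filterᵇ-cartesianProduct (λ (u , v) → S u ∧ adj G u v) id) (sum-cong-≗ row)
    where
    row : ∀ u → ∑[ v < n ] ⟦ S u ∧ adj G u v ⟧ ≡ ⟦ S u ⟧ * deg G u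
    row u with S u
    ... | true = trans (sym (deg≡∑ G u)) (sym (+-identityʳ (deg G u)))
    ... | false = sum-replicate-zero n

  length-dartsFrom-high+low : length (dartsFrom high) + length (dartsFrom low) ≡ 2 * numEdges G
  length-dartsFrom-high+low = begin
    length (dartsFrom high) + length (dartsFrom low)  ≡⟨ cong₂ _+_ (length-dartsFrom high) (length-dartsFrom low) ⟩
    ∑[ u < n ] (⟦ high u ⟧ * deg G u) + ∑[ u < n ] (⟦ low u ⟧ * deg G u)
                                                      ≡⟨ ∑-distrib-+ (λ u → ⟦ high u ⟧ * deg G u) _ ⟨
    ∑[ u < n ] (⟦ high u ⟧ * deg G u + ⟦ low u ⟧ * deg G u)
                                                      ≡⟨ sum-cong-≗ (λ u → partition (high u) (deg G u)) ⟩
    ∑[ u < n ] deg G u                                ≡⟨ handshake G ⟨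
    2 * numEdges G                                    ∎
    where
    open ≡-Reasoning
    partition : ∀ b d → ⟦ b ⟧ * d + ⟦ not b ⟧ * d ≡ d
    partition true d = trans (+-identityʳ (d + 0)) (+-identityʳ d)
    partition false d = +-identityʳ d

  module _ (minDeg : ∀ v → 2 ≤ deg G v) where

    deg≢2⇒high : ∀ {v} → deg G v ≢ 2 → T (high v)
    deg≢2⇒high {v} deg≢2 = ≤⇒≤ᵇ (≤∧≢⇒< (minDeg v) (≢-sym deg≢2))

    deg≡2⇒low : ∀ {v} → deg G v ≡ 2 → T (low v)
    deg≡2⇒low deg≡2 rewrite deg≡2 = _

    length-dartsFrom-low : length (dartsFrom low) ≡ 2 * ∣ low ∣
    length-dartsFrom-low = trans (length-dartsFrom low)
                             (trans (sum-cong-≗ twice) (sym (*-distribˡ-sum 2 (λ u → ⟦ low u ⟧))))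
      where
      twice : ∀ u → ⟦ low u ⟧ * deg G u ≡ 2 * ⟦ low u ⟧
      twice u with high u in high-u
      ... | true = refl
      ... | false = trans (+-identityʳ (deg G u))
                      (≤-antisym (≤-pred (≰⇒> (λ 3≤deg → subst T high-u (≤⇒≤ᵇ 3≤deg)))) (minDeg u))

    3∣high∣≤length-dartsFrom-high : 3 * ∣ high ∣ ≤ length (dartsFrom high)
    3∣high∣≤length-dartsFrom-high = begin
      3 * ∣ high ∣                         ≡⟨ *-distribˡ-sum 3 (λ u → ⟦ high u ⟧) ⟩
      ∑[ u < n ] (3 * ⟦ high u ⟧)          ≤⟨ ∑-mono-≤ atLeast3 ⟩
      ∑[ u < n ] (⟦ high u ⟧ * deg G u)    ≡⟨ length-dartsFrom high ⟨
      length (dartsFrom high)              ∎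
      where
      open ≤-Reasoning
      atLeast3 : ∀ u → 3 * ⟦ high u ⟧ ≤ ⟦ high u ⟧ * deg G u
      atLeast3 u with high u in high-u
      ... | true = ≤-trans (≤ᵇ⇒≤ 3 (deg G u) (subst T (sym high-u) _)) (m≤m+n (deg G u) 0)
      ... | false = z≤n

    firstDart∈dartsFrom-high : ∀ {P} (p : IsMaxInducedPath G P) → firstDart G p ∈ dartsFrom high
    firstDart∈dartsFrom-high (_ , _ , _ , _ , refl , _ , v₀~w ∷ _ , _ , deg-v₀ , _) =
      ∈-dartsFrom high (deg≢2⇒high deg-v₀) v₀~w

    swap-firstDart∈dartsFrom-low : ∀ {P} (p : IsMaxInducedPath G P) → swap (firstDart G p) ∈ dartsFrom low
    swap-firstDart∈dartsFrom-low (_ , _ , _ , _ , refl , _ , v₀~w ∷ _ , deg-w ∷ _ , _) =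
      ∈-dartsFrom low (deg≡2⇒low deg-w) (Adj-sym G v₀~w)

    endDarts⊆dartsFrom-high : ∀ {Ps} (ps : All (IsMaxInducedPath G) Ps) → endDarts G ps ⊆ dartsFrom high
    endDarts⊆dartsFrom-high ps = All.lookup (All-endDarts G firstDart∈dartsFrom-high ps)

    swap-endDarts⊆dartsFrom-low : ∀ {Ps} (ps : All (IsMaxInducedPath G) Ps) →
                                  map swap (endDarts G ps) ⊆ dartsFrom low
    swap-endDarts⊆dartsFrom-low ps = All.lookup (All.map⁺ (All-endDarts G swap-firstDart∈dartsFrom-low ps))

    2*length≤length-dartsFrom-high : ∀ {Ps} (ps : All (IsMaxInducedPath G) Ps) → AllPairs DistinctUpToReversal Ps →
                                     2 * length Ps ≤ length (dartsFrom high)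
    2*length≤length-dartsFrom-high ps distinct =
      subst (_≤ _) (length-endDarts G ps)
        (Unique-length-≤ (endDarts-unique G ps distinct) (endDarts⊆dartsFrom-high ps))

    2*length≤length-dartsFrom-low : ∀ {Ps} (ps : All (IsMaxInducedPath G) Ps) → AllPairs DistinctUpToReversal Ps →
                                    2 * length Ps ≤ length (dartsFrom low)
    2*length≤length-dartsFrom-low ps distinct =
      subst (_≤ _) (trans (length-map swap (endDarts G ps)) (length-endDarts G ps))
        (Unique-length-≤ (Unique.map⁺ (cong swap) (endDarts-unique G ps distinct))
                         (swap-endDarts⊆dartsFrom-low ps))

    length≤n : ∀ {Ps} (ps : All (IsMaxInducedPath G) Ps) → AllPairs DistinctUpToReversal Ps → length Ps ≤ n
    length≤n {Ps} ps distinct = *-cancelˡ-≤ 2 (begin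
      2 * length Ps             ≤⟨ 2*length≤length-dartsFrom-low ps distinct ⟩
      length (dartsFrom low)    ≡⟨ length-dartsFrom-low ⟩
      2 * ∣ low ∣               ≤⟨ *-monoʳ-≤ 2 (m≤m+n ∣ low ∣ ∣ high ∣) ⟩
      2 * (∣ low ∣ + ∣ high ∣)  ≡⟨ cong (2 *_) ∣low∣+∣high∣≡n ⟩
      2 * n                     ∎)
      where open ≤-Reasoning

    module _ {k : ℕ} (numEdges≤k+n : numEdges G ≤ k + n) where

      length-dartsFrom-high≤ : length (dartsFrom high) ≤ 2 * k + 2 * ∣ high ∣
      length-dartsFrom-high≤ = +-cancelʳ-≤ (2 * ∣ low ∣) _ _ (begin
        length (dartsFrom high) + 2 * ∣ low ∣              ≡⟨ cong (length (dartsFrom high) +_) length-dartsFrom-low ⟨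
        length (dartsFrom high) + length (dartsFrom low)   ≡⟨ length-dartsFrom-high+low ⟩
        2 * numEdges G                                     ≤⟨ *-monoʳ-≤ 2 numEdges≤k+n ⟩
        2 * (k + n)                                        ≡⟨ cong (λ v → 2 * (k + v)) ∣low∣+∣high∣≡n ⟨
        2 * (k + (∣ low ∣ + ∣ high ∣))                     ≡⟨ regroup k ∣ low ∣ ∣ high ∣ ⟩
        2 * k + 2 * ∣ high ∣ + 2 * ∣ low ∣                 ∎)
        where
        open ≤-Reasoning
        regroup : ∀ k l h → 2 * (k + (l + h)) ≡ 2 * k + 2 * h + 2 * l
        regroup = solve-∀

      ∣high∣≤2*k : ∣ high ∣ ≤ 2 * k
      ∣high∣≤2*k = +-cancelʳ-≤ (2 * ∣ high ∣) _ _ (begin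
        3 * ∣ high ∣                ≤⟨ 3∣high∣≤length-dartsFrom-high ⟩
        length (dartsFrom high)     ≤⟨ length-dartsFrom-high≤ ⟩
        2 * k + 2 * ∣ high ∣        ∎)
        where open ≤-Reasoning

      length≤3*k : ∀ {Ps} (ps : All (IsMaxInducedPath G) Ps) → AllPairs DistinctUpToReversal Ps →
                   length Ps ≤ 3 * k
      length≤3*k {Ps} ps distinct = *-cancelˡ-≤ 2 (begin
        2 * length Ps               ≤⟨ 2*length≤length-dartsFrom-high ps distinct ⟩
        length (dartsFrom high)     ≤⟨ length-dartsFrom-high≤ ⟩
        2 * k + 2 * ∣ high ∣        ≤⟨ +-monoʳ-≤ (2 * k) (*-monoʳ-≤ 2 ∣high∣≤2*k) ⟩
        2 * k + 2 * (2 * k)         ≡⟨ regroup k ⟩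
        2 * (3 * k)                 ∎)
        where
        open ≤-Reasoning
        regroup : ∀ k → 2 * k + 2 * (2 * k) ≡ 2 * (3 * k)
        regroup = solve-∀

module _ {n : ℕ} (G : Graph n) where

  deg≡0⇒¬Adj : ∀ {v x} → deg G v ≡ 0 → ¬ Adj G v x
  deg≡0⇒¬Adj {v} deg≡0 v~x with filterᵇ (adj G v) (allFin n) | ∈-neighbours G v~x
  ... | [] | ()

  module _ (connected : Connected G) {v} (deg≡0 : deg G v ≡ 0) where

    isolated⇒only-vertex : ∀ u → u ≡ v
    isolated⇒only-vertex u with connected v u
    ... | Reach.here = refl
    ... | Reach.there v~w _ = ⊥-elim (deg≡0⇒¬Adj deg≡0 v~w)

    isolated⇒no-highDegVertices : length (highDegVertices G) ≡ 0
    isolated⇒no-highDegVertices =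
      trans (length-highDegVertices G) (trans (sum-cong-≗ not-high) (sum-replicate-zero n))
      where
      not-high : ∀ u → ⟦ high G u ⟧ ≡ 0
      not-high u rewrite isolated⇒only-vertex u | deg≡0 = refl

    isolated⇒¬IsMaxInducedPath : ∀ {P} → ¬ IsMaxInducedPath G P
    isolated⇒¬IsMaxInducedPath (_ , w , _ , _ , _ , _ , _ , deg-w ∷ _ , _)
      with refl ← isolated⇒only-vertex w = contradiction (trans (sym deg≡0) deg-w) λ ()

lemma2 : (n k : ℕ) (G : Graph n)
    → Connected G
    → IsFeedbackEdgeNumber G k
    → (∀ v → deg G v ≢ 1)
    → (length (highDegVertices G) ≤ n ⊓ (2 * k))
    × (∀ (Ps : List (List (Fin n)))
    → All (IsMaxInducedPath G) Ps
    → AllPairs (λ P Q → P ≢ Q × P ≢ reverse Q) Ps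
    → length Ps ≤ n ⊓ (3 * k))
-- only the forest reached by deleting k edges is used, not the minimality of k
lemma2 n k G connected ((H , _ , forest , deleted≡k) , _) noLeaf with any? (λ v → deg G v ≟ℕ 0)
... | yes (v , deg≡0) =
  subst (_≤ n ⊓ (2 * k)) (sym (isolated⇒no-highDegVertices G connected deg≡0)) z≤n ,
  λ { [] _ _ → z≤n ; (_ ∷ _) (p ∷ _) _ → ⊥-elim (isolated⇒¬IsMaxInducedPath G connected deg≡0 p) }
... | no noIsolated =
  ⊓-glb (subst (_≤ n) (sym (length-highDegVertices G)) (∣high∣≤n G))
        (subst (_≤ 2 * k) (sym (length-highDegVertices G)) (∣high∣≤2*k G minDeg numEdges≤k+n)) ,
  λ Ps ps distinct → ⊓-glb (length≤n G minDeg ps distinct) (length≤3*k G minDeg numEdges≤k+n ps distinct)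
  where
  minDeg : ∀ v → 2 ≤ deg G v
  minDeg v with deg G v in deg-v
  ... | 0 = ⊥-elim (noIsolated (v , deg-v))
  ... | 1 = ⊥-elim (noLeaf v deg-v)
  ... | suc (suc _) = s≤s (s≤s z≤n)
  numEdges≤k+n : numEdges G ≤ k + n
  numEdges≤k+n = begin
    numEdges G                                ≤⟨ m≤n+m∸n (numEdges G) (numEdges H) ⟩
    numEdges H + (numEdges G ∸ numEdges H)    ≡⟨ cong (numEdges H +_) deleted≡k ⟩
    numEdges H + k                            ≤⟨ +-monoˡ-≤ k (Forest⇒numEdges≤n H forest) ⟩
    n + k                                     ≡⟨ +-comm n k ⟩
    k + n                                     ∎
    where open ≤-Reasoning
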